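{- For a linear code $\mathcal{C}\subseteq\mathbb{F}_q^n$ of dimension $k$ and a set $S\subseteq[n]$, there exists a basis $\vec{B}=(\vec{b}_1;\dots;\vec{b}_k)$ of $\mathcal{C}$ with $S\subseteq\mathsf{Supp}(\vec{b}_k^+)$ if and only if $S$ is redundant for $\mathcal{C}$.
   Context: $\mathsf{Supp}(\vec{x})=\{i:x_i\ne0\}$, $\mathsf{Supp}(\mathcal{C})=\bigcup_{\vec{c}\in\mathcal{C}}\mathsf{Supp}(\vec{c})$. $\pi^\perp_{\{\vec{x}_1,\dots,\vec{x}_m\}}$ zeroes all coordinates in $\bigcup_j\mathsf{Supp}(\vec{x}_j)$; $\vec{b}_k^+:=\pi^\perp_{\{\vec{b}_1,\dots,\vec{b}_{k-1}\}}(\vec{b}_k)$. $S$ is redundant for $\mathcal{C}$ if $S\subseteq\mathsf{Supp}(\mathcal{C})$ and for every $\vec{c}\in\mathcal{C}$ and all $i,j\in S$, $c_i=0$ iff $c_j=0$. -}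

module Defs where

open import Level using (Level; _⊔_) renaming (suc to lsuc)
open import Data.Nat using (ℕ; zero; suc)
open import Data.Fin using (Fin; zero; suc; fromℕ; inject₁)
open import Data.Fin.Subset using (Subset; _∈_)
open import Data.Product using (Σ; ∃; _×_; _,_)
open import Data.List using (List)
open import Data.List.Relation.Unary.Any using (Any)
open import Relation.Nullary using (¬_; yes; no)
open import Relation.Binary using (Decidable)
open import Algebra.Bundles using (CommutativeRing)

record FiniteField (c ℓ : Level) : Set (lsuc (c ⊔ ℓ)) where
  field
    commRing : CommutativeRing c ℓ
  open CommutativeRing commRing public
  field
    0≉1      : ¬ (0# ≈ 1#)
    inverse  : ∀ x → ¬ (x ≈ 0#) → ∃ λ y → (x * y) ≈ 1#
    _≟_      : Decidable _≈_
    elements : List Carrier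
    complete : ∀ x → Any (x ≈_) elements

module Code {c ℓ : Level} (F : FiniteField c ℓ) where
  open FiniteField F using (Carrier; _≈_; _+_; _*_; 0#; _≟_)

  Vect : ℕ → Set c
  Vect n = Fin n → Carrier

  _≋_ : ∀ {n} → Vect n → Vect n → Set ℓ
  u ≋ v = ∀ i → u i ≈ v i

  0V : ∀ {n} → Vect n
  0V i = 0#

  _+V_ : ∀ {n} → Vect n → Vect n → Vect n
  (u +V v) i = u i + v i

  _·V_ : ∀ {n} → Carrier → Vect n → Vect n
  (a ·V v) i = a * v i

  lincomb : ∀ {n k} → (Fin k → Carrier) → (Fin k → Vect n) → Vect n
  lincomb {k = zero}  a b = 0V
  lincomb {k = suc k} a b = (a zero ·V b zero) +V lincomb (λ i → a (suc i)) (λ i → b (suc i))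

  record IsLinearCode {n : ℕ} {p : Level} (C : Vect n → Set p) : Set (c ⊔ ℓ ⊔ p) where
    field
      respects : ∀ {u v} → u ≋ v → C u → C v
      zero∈    : C 0V
      +-closed : ∀ {u v} → C u → C v → C (u +V v)
      ·-closed : ∀ a {v} → C v → C (a ·V v)

  LinIndep : ∀ {n k} → (Fin k → Vect n) → Set (c ⊔ ℓ)
  LinIndep B = ∀ a → lincomb a B ≋ 0V → ∀ i → a i ≈ 0#

  InSpan : ∀ {n k} → (Fin k → Vect n) → Vect n → Set (c ⊔ ℓ)
  InSpan B v = ∃ λ a → lincomb a B ≋ v

  IsBasis : ∀ {n k p} → (Vect n → Set p) → (Fin k → Vect n) → Set (c ⊔ ℓ ⊔ p)
  IsBasis C B = (∀ i → C (B i)) × LinIndep B × (∀ v → C v → InSpan B v)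

  HasDim : ∀ {n p} → (Vect n → Set p) → ℕ → Set (c ⊔ ℓ ⊔ p)
  HasDim {n} C k = Σ (Fin k → Vect n) λ B → IsBasis C B

  Supp : ∀ {n} → Vect n → Fin n → Set ℓ
  Supp x i = ¬ (x i ≈ 0#)

  SuppCode : ∀ {n p} → (Vect n → Set p) → Fin n → Set (c ⊔ ℓ ⊔ p)
  SuppCode C i = ∃ λ x → C x × ¬ (x i ≈ 0#)

  zeroOn : ∀ {n} → Vect n → Vect n → Vect n
  zeroOn x v i with x i ≟ 0#
  ... | yes _ = v i
  ... | no  _ = 0#

  proj⊥ : ∀ {n m} → (Fin m → Vect n) → Vect n → Vect n
  proj⊥ {m = zero}  xs v = v
  proj⊥ {m = suc m} xs v = zeroOn (xs zero) (proj⊥ (λ j → xs (suc j)) v)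

  -- b_k^+ = π^⊥_{b_1,...,b_{k-1}}(b_k) for a basis of length k = suc k'
  lastPlus : ∀ {n k} → (Fin (suc k) → Vect n) → Vect n
  lastPlus {k = k} B = proj⊥ (λ j → B (inject₁ j)) (B (fromℕ k))

  _⊆P_ : ∀ {n a} → Subset n → (Fin n → Set a) → Set a
  S ⊆P P = ∀ i → i ∈ S → P i

  Redundant : ∀ {n p} → Subset n → (Vect n → Set p) → Set (c ⊔ ℓ ⊔ p)
  Redundant S C =
    (S ⊆P SuppCode C) ×
    (∀ x → C x → ∀ i j → i ∈ S → j ∈ S →
       (x i ≈ 0# → x j ≈ 0#) × (x j ≈ 0# → x i ≈ 0#))

-- If b_k⁺ is nonzero on S, then b_1, …, b_{k-1} vanish on S and b_k does not,
-- so on S every codeword is a scalar multiple of b_k: its coordinates there are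
-- all zero or all nonzero.  Conversely, fix i ∈ S (for S empty any basis works).
-- Some basis vector is nonzero at i, so the operations b_l ↦ b_l + c_l b_t, which
-- preserve bases when c_t = 0, yield a basis whose last vector is the only one
-- nonzero at i; redundancy transports both facts from i to every j ∈ S, and
-- then the projection leaves b_k unchanged on S.
module Submission where

open import Defs
open import Level using (Level)
open import Data.Nat using (ℕ; zero; suc)
open import Data.Fin using (Fin; zero; suc; fromℕ; inject₁; lower₁; toℕ; punchIn)
  renaming (_≟_ to _≟ᶠ_)
open import Data.Fin.Properties
  using (any?; fromℕ≢inject₁; inject₁-lower₁; toℕ-injective; toℕ-fromℕ; punchInᵢ≢i)
open import Data.Fin.Subset using (Subset; _∈_)
open import Data.Fin.Subset.Properties using (_∈?_)
open import Data.Vec.Functional using (updateAt; removeAt)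
open import Data.Vec.Functional.Properties using (updateAt-updates; updateAt-minimal)
open import Data.Product using (Σ; ∃; _×_; _,_; proj₁; proj₂)
open import Data.Empty using (⊥-elim)
open import Function using (_∘_; const)
open import Function.Bundles using (_⇔_; mk⇔; Equivalence)
open import Relation.Nullary using (¬_; yes; no; ¬?)
open import Relation.Nullary.Decidable using (decidable-stable)
open import Relation.Binary.PropositionalEquality as P using (_≡_; _≢_)
import Algebra.Properties.Ring as RingProperties
import Algebra.Properties.Semiring.Sum as SemiringSum
import Algebra.Properties.CommutativeSemigroup as CommutativeSemigroupProperties
import Relation.Binary.Reasoning.Setoid as SetoidReasoning

∀inject₁⇒∀≢fromℕ : ∀ {a k} {P : Fin (suc k) → Set a} →
                   (∀ l → P (inject₁ l)) → ∀ l → l ≢ fromℕ k → P l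
∀inject₁⇒∀≢fromℕ {k = k} {P} p l l≢k = P.subst P (inject₁-lower₁ l k≢l) (p (lower₁ l k≢l))
  where
  k≢l : k ≢ toℕ l
  k≢l k≡l = l≢k (toℕ-injective (P.trans (P.sym k≡l) (P.sym (toℕ-fromℕ k))))

module LinearAlgebra {c ℓ : Level} (F : FiniteField c ℓ) where
  open FiniteField F hiding (zero)
  open Code F
  open RingProperties ring using (-‿distribˡ-*)
  open SemiringSum semiring using (sum; sum-remove; sum-cong-≋; sum-replicate-zero; ∑-distrib-+; *-distribʳ-sum)
  open CommutativeSemigroupProperties +-commutativeSemigroup using (xy∙z≈xz∙y)
  open SetoidReasoning setoid

  x*y≈0⇒x≈0 : ∀ {x y} → ¬ y ≈ 0# → x * y ≈ 0# → x ≈ 0#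
  x*y≈0⇒x≈0 {x} {y} y≉0 xy≈0 with inverse y y≉0
  ... | y⁻¹ , yy⁻¹≈1 = begin
    x              ≈⟨ *-identityʳ x ⟨
    x * 1#         ≈⟨ *-congˡ yy⁻¹≈1 ⟨
    x * (y * y⁻¹)  ≈⟨ *-assoc x y y⁻¹ ⟨
    x * y * y⁻¹    ≈⟨ *-congʳ xy≈0 ⟩
    0# * y⁻¹       ≈⟨ zeroˡ y⁻¹ ⟩
    0#             ∎

  x+-y*z+y*z≈x : ∀ x y z → x + - y * z + y * z ≈ x
  x+-y*z+y*z≈x x y z = begin
    x + - y * z + y * z    ≈⟨ +-assoc x _ _ ⟩
    x + (- y * z + y * z)  ≈⟨ +-congˡ (distribʳ z (- y) y) ⟨
    x + (- y + y) * z      ≈⟨ +-congˡ (*-congʳ (-‿inverseˡ y)) ⟩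
    x + 0# * z             ≈⟨ +-congˡ (zeroˡ z) ⟩
    x + 0#                 ≈⟨ +-identityʳ x ⟩
    x                      ∎

  x+-[x*y]*z≈0 : ∀ x y z → z * y ≈ 1# → x + - (x * y) * z ≈ 0#
  x+-[x*y]*z≈0 x y z zy≈1 = begin
    x + - (x * y) * z    ≈⟨ +-congˡ (-‿distribˡ-* (x * y) z) ⟨
    x + - (x * y * z)    ≈⟨ +-congˡ (-‿cong (*-assoc x y z)) ⟩
    x + - (x * (y * z))  ≈⟨ +-congˡ (-‿cong (*-congˡ (trans (*-comm y z) zy≈1))) ⟩
    x + - (x * 1#)       ≈⟨ +-congˡ (-‿cong (*-identityʳ x)) ⟩
    x + - x              ≈⟨ -‿inverseʳ x ⟩
    0#                   ∎

  sum-≈0 : ∀ {k} (f : Fin k → Carrier) → (∀ l → f l ≈ 0#) → sum f ≈ 0#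
  sum-≈0 {k} f f≈0 = trans (sum-cong-≋ f≈0) (sum-replicate-zero k)

  sum-differsAt : ∀ {k} (f g : Fin (suc k) → Carrier) t x →
                  (∀ l → l ≢ t → f l ≈ g l) → f t ≈ g t + x → sum f ≈ sum g + x
  sum-differsAt f g t x f≈g ft≈gt+x = begin
    sum f                               ≈⟨ sum-remove {i = t} f ⟩
    f t + sum (removeAt f t)            ≈⟨ +-cong ft≈gt+x (sum-cong-≋ (λ l → f≈g (punchIn t l) (punchInᵢ≢i t l))) ⟩
    g t + x + sum (removeAt g t)        ≈⟨ xy∙z≈xz∙y (g t) x _ ⟩
    g t + sum (removeAt g t) + x        ≈⟨ +-congʳ (sum-remove {i = t} g) ⟨
    sum g + x                           ∎

  sum-concentratedAt : ∀ {k} (f : Fin (suc k) → Carrier) t →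
                       (∀ l → l ≢ t → f l ≈ 0#) → sum f ≈ f t
  sum-concentratedAt {k} f t f≈0 = begin
    sum f                         ≈⟨ sum-differsAt f (const 0#) t (f t) f≈0 (sym (+-identityˡ (f t))) ⟩
    sum {suc k} (const 0#) + f t  ≈⟨ +-congʳ (sum-replicate-zero (suc k)) ⟩
    0# + f t                      ≈⟨ +-identityˡ (f t) ⟩
    f t                           ∎

  lincomb-coord : ∀ {n k} (a : Fin k → Carrier) (B : Fin k → Vect n) j →
                  lincomb a B j ≡ sum (λ l → a l * B l j)
  lincomb-coord {k = zero}  a B j = P.refl
  lincomb-coord {k = suc k} a B j = P.cong (a zero * B zero j +_) (lincomb-coord (a ∘ suc) (B ∘ suc) j)

  lincomb-≈0 : ∀ {n k} (a : Fin k → Carrier) (B : Fin k → Vect n) j →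
               (∀ l → B l j ≈ 0#) → lincomb a B j ≈ 0#
  lincomb-≈0 a B j B≈0 = trans (reflexive (lincomb-coord a B j))
    (sum-≈0 (λ l → a l * B l j) (λ l → trans (*-congˡ (B≈0 l)) (zeroʳ (a l))))

  lincomb-concentratedAt : ∀ {n k} (a : Fin (suc k) → Carrier) (B : Fin (suc k) → Vect n) t j →
                           (∀ l → l ≢ t → B l j ≈ 0#) → lincomb a B j ≈ a t * B t j
  lincomb-concentratedAt a B t j B≈0 = trans (reflexive (lincomb-coord a B j))
    (sum-concentratedAt _ t (λ l l≢t → trans (*-congˡ (B≈0 l l≢t)) (zeroʳ (a l))))

  lincomb-updateAt : ∀ {n k} (a : Fin (suc k) → Carrier) (B : Fin (suc k) → Vect n) t s j →
                     lincomb (updateAt a t (_+ s)) B j ≈ lincomb a B j + s * B t j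
  lincomb-updateAt a B t s j = begin
    lincomb (updateAt a t (_+ s)) B j           ≡⟨ lincomb-coord (updateAt a t (_+ s)) B j ⟩
    sum (λ l → updateAt a t (_+ s) l * B l j)   ≈⟨ sum-differsAt _ (λ l → a l * B l j) t (s * B t j) off on ⟩
    sum (λ l → a l * B l j) + s * B t j         ≡⟨ P.cong (_+ s * B t j) (lincomb-coord a B j) ⟨
    lincomb a B j + s * B t j                   ∎
    where
    off : ∀ l → l ≢ t → updateAt a t (_+ s) l * B l j ≈ a l * B l j
    off l l≢t = *-congʳ (reflexive (updateAt-minimal l t a l≢t))
    on : updateAt a t (_+ s) t * B t j ≈ a t * B t j + s * B t j
    on = trans (*-congʳ (reflexive (updateAt-updates t a))) (distribʳ (B t j) (a t) s)

  shear : ∀ {n k} → (Fin k → Vect n) → Fin k → (Fin k → Carrier) → Fin k → Vect n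
  shear B t c l = B l +V (c l ·V B t)

  lincomb-shear : ∀ {n k} (a : Fin k → Carrier) (B : Fin k → Vect n) t c j →
                  lincomb a (shear B t c) j ≈ lincomb a B j + sum (λ l → a l * c l) * B t j
  lincomb-shear a B t c j = begin
    lincomb a (shear B t c) j                                        ≡⟨ lincomb-coord a (shear B t c) j ⟩
    sum (λ l → a l * (B l j + c l * B t j))                          ≈⟨ sum-cong-≋ expand ⟩
    sum (λ l → a l * B l j + a l * c l * B t j)                      ≈⟨ ∑-distrib-+ (λ l → a l * B l j) (λ l → a l * c l * B t j) ⟩
    sum (λ l → a l * B l j) + sum (λ l → a l * c l * B t j)          ≈⟨ +-cong (reflexive (lincomb-coord a B j))
                                                                                (*-distribʳ-sum (B t j) (λ l → a l * c l)) ⟨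
    lincomb a B j + sum (λ l → a l * c l) * B t j                    ∎
    where
    expand : ∀ l → a l * (B l j + c l * B t j) ≈ a l * B l j + a l * c l * B t j
    expand l = trans (distribˡ (a l) _ _) (+-congˡ (sym (*-assoc (a l) (c l) (B t j))))

  shear-linIndep : ∀ {n k} (B : Fin (suc k) → Vect n) t c →
                   c t ≈ 0# → LinIndep B → LinIndep (shear B t c)
  shear-linIndep B t c ct≈0 indep a aB′≈0 = a≈0
    where
    s : Carrier
    s = sum (λ l → a l * c l)
    a′≈0 : ∀ l → updateAt a t (_+ s) l ≈ 0#
    a′≈0 = indep _ (λ j → trans (lincomb-updateAt a B t s j) (trans (sym (lincomb-shear a B t c j)) (aB′≈0 j)))
    off : ∀ l → l ≢ t → a l ≈ 0#
    off l l≢t = trans (reflexive (P.sym (updateAt-minimal l t a l≢t))) (a′≈0 l)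
    s≈0 : s ≈ 0#
    s≈0 = trans (sum-concentratedAt _ t (λ l l≢t → trans (*-congʳ (off l l≢t)) (zeroˡ (c l))))
                (trans (*-congˡ ct≈0) (zeroʳ (a t)))
    at≈0 : a t ≈ 0#
    at≈0 = begin
      a t                     ≈⟨ +-identityʳ (a t) ⟨
      a t + 0#                ≈⟨ +-congˡ s≈0 ⟨
      a t + s                 ≡⟨ updateAt-updates t a ⟨
      updateAt a t (_+ s) t   ≈⟨ a′≈0 t ⟩
      0#                      ∎
    a≈0 : ∀ l → a l ≈ 0#
    a≈0 l with l ≟ᶠ t
    ... | yes P.refl = at≈0
    ... | no l≢t     = off l l≢t

  shear-inSpan : ∀ {n k} (B : Fin (suc k) → Vect n) t c {v} →
                 c t ≈ 0# → InSpan B v → InSpan (shear B t c) v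
  shear-inSpan {k = k} B t c {v} ct≈0 (a , aB≈v) = a′ , a′B′≈v
    where
    s : Carrier
    s = sum (λ l → a l * c l)
    a′ : Fin (suc k) → Carrier
    a′ = updateAt a t (_+ - s)
    a′ct≈0 : a′ t * c t ≈ 0#
    a′ct≈0 = trans (*-congˡ ct≈0) (zeroʳ (a′ t))
    act+0≈0 : a t * c t + 0# ≈ 0#
    act+0≈0 = trans (+-identityʳ _) (trans (*-congˡ ct≈0) (zeroʳ (a t)))
    s′≈s : sum (λ l → a′ l * c l) ≈ s
    s′≈s = trans (sum-differsAt (λ l → a′ l * c l) (λ l → a l * c l) t 0#
                   (λ l l≢t → *-congʳ (reflexive (updateAt-minimal l t a l≢t)))
                   (trans a′ct≈0 (sym act+0≈0)))
                 (+-identityʳ s)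
    a′B′≈v : lincomb a′ (shear B t c) ≋ v
    a′B′≈v j = begin
      lincomb a′ (shear B t c) j                           ≈⟨ lincomb-shear a′ B t c j ⟩
      lincomb a′ B j + sum (λ l → a′ l * c l) * B t j      ≈⟨ +-cong (lincomb-updateAt a B t (- s) j) (*-congʳ s′≈s) ⟩
      lincomb a B j + - s * B t j + s * B t j              ≈⟨ x+-y*z+y*z≈x (lincomb a B j) s (B t j) ⟩
      lincomb a B j                                        ≈⟨ aB≈v j ⟩
      v j                                                  ∎

  proj⊥-≈ : ∀ {n m} (xs : Fin m → Vect n) v j → (∀ l → xs l j ≈ 0#) → proj⊥ xs v j ≈ v j
  proj⊥-≈ {m = zero}  xs v j xs≈0 = refl
  proj⊥-≈ {m = suc m} xs v j xs≈0 with xs zero j ≟ 0#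
  ... | yes _   = proj⊥-≈ (xs ∘ suc) v j (xs≈0 ∘ suc)
  ... | no x₀≉0 = ⊥-elim (x₀≉0 (xs≈0 zero))

  Supp-proj⊥⇒≈0 : ∀ {n m} (xs : Fin m → Vect n) v j → Supp (proj⊥ xs v) j → ∀ l → xs l j ≈ 0#
  Supp-proj⊥⇒≈0 {m = suc m} xs v j supp l with xs zero j ≟ 0#
  Supp-proj⊥⇒≈0 {m = suc m} xs v j supp zero    | yes x₀≈0 = x₀≈0
  Supp-proj⊥⇒≈0 {m = suc m} xs v j supp (suc l) | yes _    = Supp-proj⊥⇒≈0 (xs ∘ suc) v j supp l
  Supp-proj⊥⇒≈0 {m = suc m} xs v j supp l       | no _     = ⊥-elim (supp refl)

  Supp-proj⊥ : ∀ {n m} (xs : Fin m → Vect n) v j →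
               Supp (proj⊥ xs v) j ⇔ ((∀ l → xs l j ≈ 0#) × Supp v j)
  Supp-proj⊥ xs v j = mk⇔
    (λ supp → let xs≈0 = Supp-proj⊥⇒≈0 xs v j supp in
              xs≈0 , λ vj≈0 → supp (trans (proj⊥-≈ xs v j xs≈0) vj≈0))
    (λ (xs≈0 , vj≉0) pj≈0 → vj≉0 (trans (sym (proj⊥-≈ xs v j xs≈0)) pj≈0))

  IsolatedOn : ∀ {n k} → (Fin k → Vect n) → Fin k → Subset n → Set ℓ
  IsolatedOn B t S = ∀ j → j ∈ S → (∀ l → l ≢ t → B l j ≈ 0#) × Supp (B t) j

  ⊆Supp-lastPlus⇔IsolatedOn : ∀ {n k} (B : Fin (suc k) → Vect n) S →
                              (S ⊆P Supp (lastPlus B)) ⇔ IsolatedOn B (fromℕ k) S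
  ⊆Supp-lastPlus⇔IsolatedOn {k = k} B S = mk⇔
    (λ S⊆ j j∈S → let earlier≈0 , lastj≉0 = Equivalence.to (Supp-lastPlus j) (S⊆ j j∈S) in
                  ∀inject₁⇒∀≢fromℕ {P = λ l → B l j ≈ 0#} earlier≈0 , lastj≉0)
    (λ isolated j j∈S → let others≈0 , lastj≉0 = isolated j j∈S in
                        Equivalence.from (Supp-lastPlus j)
                          ((λ l → others≈0 (inject₁ l) (fromℕ≢inject₁ ∘ P.sym)) , lastj≉0))
    where
    Supp-lastPlus : ∀ j → Supp (lastPlus B) j ⇔ ((∀ l → B (inject₁ l) j ≈ 0#) × Supp (B (fromℕ k)) j)
    Supp-lastPlus = Supp-proj⊥ (B ∘ inject₁) (B (fromℕ k))

  module _ {n p} {C : Vect n → Set p} where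

    basis-covers-SuppCode : ∀ {k} {B : Fin k → Vect n} → IsBasis C B →
                            ∀ {i} → SuppCode C i → ∃ λ m → Supp (B m) i
    basis-covers-SuppCode {B = B} (_ , _ , spans) {i} (x , x∈C , xi≉0)
      with any? (λ m → ¬? (B m i ≟ 0#))
    ... | yes found = found
    ... | no none with spans x x∈C
    ...   | a , aB≈x = ⊥-elim (xi≉0 (trans (sym (aB≈x i)) (lincomb-≈0 a B i Bi≈0)))
      where
      Bi≈0 : ∀ m → B m i ≈ 0#
      Bi≈0 m = decidable-stable (B m i ≟ 0#) (λ Bmi≉0 → none (m , Bmi≉0))

    isolated⇒redundant : ∀ {k} {B : Fin (suc k) → Vect n} {t S} →
                         IsBasis C B → IsolatedOn B t S → Redundant S C
    isolated⇒redundant {B = B} {t} {S} (B∈C , _ , spans) isolated = S⊆SuppC , sameZeros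
      where
      S⊆SuppC : S ⊆P SuppCode C
      S⊆SuppC i i∈S = B t , B∈C t , proj₂ (isolated i i∈S)
      zeroTransfer : ∀ {x} → C x → ∀ {i j} → i ∈ S → j ∈ S → x i ≈ 0# → x j ≈ 0#
      zeroTransfer {x} x∈C {i} {j} i∈S j∈S xi≈0 with spans x x∈C
      ... | a , aB≈x = trans (x≈atB j∈S) (trans (*-congʳ at≈0) (zeroˡ (B t j)))
        where
        x≈atB : ∀ {j} → j ∈ S → x j ≈ a t * B t j
        x≈atB {j} j∈S = trans (sym (aB≈x j)) (lincomb-concentratedAt a B t j (proj₁ (isolated j j∈S)))
        at≈0 : a t ≈ 0#
        at≈0 = x*y≈0⇒x≈0 (proj₂ (isolated i i∈S)) (trans (sym (x≈atB i∈S)) xi≈0)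
      sameZeros : ∀ x → C x → ∀ i j → i ∈ S → j ∈ S → (x i ≈ 0# → x j ≈ 0#) × (x j ≈ 0# → x i ≈ 0#)
      sameZeros x x∈C i j i∈S j∈S = zeroTransfer x∈C i∈S j∈S , zeroTransfer x∈C j∈S i∈S

    module _ (code : IsLinearCode C) where
      open IsLinearCode code

      shear-isBasis : ∀ {k} (B : Fin (suc k) → Vect n) t c →
                      c t ≈ 0# → IsBasis C B → IsBasis C (shear B t c)
      shear-isBasis B t c ct≈0 (B∈C , indep , spans) =
        (λ l → +-closed (B∈C l) (·-closed (c l) (B∈C t))) ,
        shear-linIndep B t c ct≈0 indep ,
        (λ v v∈C → shear-inSpan B t c ct≈0 (spans v v∈C))

      pivotAt : ∀ {k} {B : Fin (suc k) → Vect n} → IsBasis C B → ∀ {i m} → Supp (B m) i →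
                (t : Fin (suc k)) → Σ (Fin (suc k) → Vect n) λ B′ → IsBasis C B′ × Supp (B′ t) i
      pivotAt {k} {B} basis {i} {m} Bmi≉0 t with B t i ≟ 0#
      ... | no Bti≉0  = B , basis , Bti≉0
      ... | yes Bti≈0 = shear B m e , shear-isBasis B m e em≈0 basis , B′ti≉0
        where
        e : Fin (suc k) → Carrier
        e = updateAt (const 0#) t (const 1#)
        m≢t : m ≢ t
        m≢t P.refl = Bmi≉0 Bti≈0
        em≈0 : e m ≈ 0#
        em≈0 = reflexive (updateAt-minimal m t (const 0#) m≢t)
        B′ti≈Bmi : B t i + e t * B m i ≈ B m i
        B′ti≈Bmi = begin
          B t i + e t * B m i  ≈⟨ +-cong Bti≈0 (*-congʳ (reflexive (updateAt-updates t (const 0#)))) ⟩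
          0# + 1# * B m i      ≈⟨ +-identityˡ _ ⟩
          1# * B m i           ≈⟨ *-identityˡ (B m i) ⟩
          B m i                ∎
        B′ti≉0 : Supp (shear B m e t) i
        B′ti≉0 B′ti≈0 = Bmi≉0 (trans (sym B′ti≈Bmi) B′ti≈0)

      clearColumn : ∀ {k} {B : Fin (suc k) → Vect n} → IsBasis C B → ∀ {i t} → Supp (B t) i →
                    Σ (Fin (suc k) → Vect n) λ B′ →
                      IsBasis C B′ × Supp (B′ t) i × (∀ l → l ≢ t → B′ l i ≈ 0#)
      clearColumn {k} {B} basis {i} {t} Bti≉0 with inverse (B t i) Bti≉0
      ... | β⁻¹ , ββ⁻¹≈1 = shear B t μ , shear-isBasis B t μ μt≈0 basis , B′ti≉0 , B′li≈0
        where
        μ : Fin (suc k) → Carrier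
        μ = updateAt (λ l → - (B l i * β⁻¹)) t (const 0#)
        μt≈0 : μ t ≈ 0#
        μt≈0 = reflexive (updateAt-updates t _)
        B′ti≉0 : Supp (shear B t μ t) i
        B′ti≉0 B′ti≈0 = Bti≉0 (begin
          B t i                ≈⟨ +-identityʳ (B t i) ⟨
          B t i + 0#           ≈⟨ +-congˡ (trans (*-congʳ μt≈0) (zeroˡ (B t i))) ⟨
          B t i + μ t * B t i  ≈⟨ B′ti≈0 ⟩
          0#                   ∎)
        B′li≈0 : ∀ l → l ≢ t → shear B t μ l i ≈ 0#
        B′li≈0 l l≢t = trans (+-congˡ (*-congʳ (reflexive (updateAt-minimal l t _ l≢t))))
                             (x+-[x*y]*z≈0 (B l i) β⁻¹ (B t i) ββ⁻¹≈1)

      reducedBasis : ∀ {k} → HasDim C (suc k) → ∀ {i} → SuppCode C i → (t : Fin (suc k)) →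
                     Σ (Fin (suc k) → Vect n) λ B →
                       IsBasis C B × Supp (B t) i × (∀ l → l ≢ t → B l i ≈ 0#)
      reducedBasis (B , basis) i∈SuppC t =
        let m , Bmi≉0 = basis-covers-SuppCode basis i∈SuppC
            B₁ , basis₁ , B₁ti≉0 = pivotAt basis Bmi≉0 t
        in clearColumn basis₁ B₁ti≉0

      redundant⇒isolated : ∀ {k S} → HasDim C (suc k) → Redundant S C → (t : Fin (suc k)) →
                           Σ (Fin (suc k) → Vect n) λ B → IsBasis C B × IsolatedOn B t S
      redundant⇒isolated {k} {S} dim (S⊆SuppC , sameZeros) t with any? (_∈? S)
      ... | no S≡∅ = proj₁ dim , proj₂ dim , λ j j∈S → ⊥-elim (S≡∅ (j , j∈S))
      ... | yes (i , i∈S) = isolate (reducedBasis dim (S⊆SuppC i i∈S) t)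
        where
        isolate : (Σ (Fin (suc k) → Vect n) λ B →
                     IsBasis C B × Supp (B t) i × (∀ l → l ≢ t → B l i ≈ 0#)) →
                  Σ (Fin (suc k) → Vect n) λ B → IsBasis C B × IsolatedOn B t S
        isolate (B , basis@(B∈C , _) , Bti≉0 , Bli≈0) = B , basis , λ j j∈S →
          (λ l l≢t → proj₁ (sameZeros (B l) (B∈C l) i j i∈S j∈S) (Bli≈0 l l≢t)) ,
          (λ Btj≈0 → Bti≉0 (proj₂ (sameZeros (B t) (B∈C t) i j i∈S j∈S) Btj≈0))

mainTheorem12 : ∀ {c ℓ p} (F : FiniteField c ℓ) {n k : ℕ}
    (C : Code.Vect F n → Set p) → Code.IsLinearCode F C → Code.HasDim F C (suc k) →
    (S : Subset n) →
    (Σ (Fin (suc k) → Code.Vect F n) (λ B → Code.IsBasis F C B × Code._⊆P_ F S (Code.Supp F (Code.lastPlus F B))))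
    ⇔ Code.Redundant F S C
mainTheorem12 F {k = k} C code dim S = mk⇔
  (λ (B , basis , S⊆B⁺) → isolated⇒redundant basis (to (⊆Supp-lastPlus⇔IsolatedOn B S) S⊆B⁺))
  (λ redundant → let B , basis , isolated = redundant⇒isolated code dim redundant (fromℕ k) in
                 B , basis , from (⊆Supp-lastPlus⇔IsolatedOn B S) isolated)
  where
  open LinearAlgebra F
  open Equivalence
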